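{- Let $\Gamma$ be a group, $\Gamma_1$ a normal subgroup, and $\mathcal A$ a collection of subgroups such that $\{\Gamma_1\}\cup\mathcal A$ partitions $\Gamma$, each $A\in\mathcal A$ is malnormal and all conjugates of members of $\mathcal A$ lie in $\mathcal A$. Let $(G,\psi)$ be a $\Gamma$-gain graph, $M=M(\Gamma,\Gamma_1,\mathcal A,G,\psi)$ and $e\in E(G)$. Then $M\setminus e\cong M(\Gamma,\Gamma_1,\mathcal A,G\setminus e,\psi|_{E(G)-e})$, where $\psi|_{E(G)-e}$ is the restriction of $\psi$ to orientations of edges other than $e$.
   Context: Conventions: graphs may have loops and parallel edges. A $\Gamma$-gain function $\psi$ maps oriented edges $(e,u,v)$ to $\Gamma$ (identity $\varepsilon$) with $\psi(e,u,v)=\psi(e,v,u)^{ -1}$ for $u\ne v$; a cycle is $\psi$-balanced if the product of gains along some simple closed walk around it is $\varepsilon$. $\psi(e)$ is the set of gain values of orientations of $e$, $\psi(X)=\bigcup_{e\in X}\psi(e)$. Switching: $\psi^\eta(e,u,v)=\eta(u)^{ -1}\psi(e,u,v)\eta(v)$. $\psi/\Gamma_1$ is $\psi$ composed with $\Gamma\to\Gamma/\Gamma_1$. Malnormal: $\gamma^{ -1}A\gamma\cap A=\{\varepsilon\}$ for $\gamma\notin A$; partition: each non-identity element in exactly one member. Frame matroid $F(G,\varphi)$: circuits are balanced cycles, tight handcuffs (two edge-disjoint cycles sharing exactly one vertex) and loose handcuffs (two vertex-disjoint cycles joined by a minimal path) with both cycles unbalanced, and theta graphs with all cycles unbalanced.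 Construction: $N=F(G,\psi/\Gamma_1)$; $\mathcal C(\Gamma,\Gamma_1,\mathcal A,G,\psi)$ is the set of circuits $C$ of $N$ that are $\psi$-balanced cycles, or handcuffs or theta graphs with $\psi^\eta(C)\subseteq A$ for some switching $\eta$ and $A\in\mathcal A$. $M(\Gamma,\Gamma_1,\mathcal A,G,\psi)$ is the matroid on $E(G)$ with rank $r_N(X)$ if every circuit of $N|X$ lies in $\mathcal C(\Gamma,\Gamma_1,\mathcal A,G,\psi)$, and $r_N(X)+1$ otherwise. -}

module Defs where

open import Level using (0ℓ)
open import Algebra.Bundles using (Group)
open import Data.Nat using (ℕ; zero; suc; _≤_)
open import Data.Fin using (Fin; inject₁; fromℕ; punchIn; _≟_)
open import Data.Fin.Subset using (Subset; _∈_; _∉_; _⊆_; ∣_∣)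
open import Data.Product using (Σ; ∃; ∃-syntax; _×_; _,_; proj₁; proj₂)
open import Data.Sum using (_⊎_)
open import Data.Bool using (if_then_else_)
open import Data.Empty using (⊥)
open import Relation.Nullary using (¬_; does)
open import Relation.Binary.PropositionalEquality using (_≡_; _≢_)
import Data.Vec.Functional as VF

infix 3 _⇔_
_⇔_ : Set → Set → Set
P ⇔ Q = (P → Q) × (Q → P)

module _ (Γ : Group 0ℓ 0ℓ) where
  open Group Γ

  record Subgroup : Set₁ where
    field
      mem   : Carrier → Set
      resp  : ∀ {x y} → x ≈ y → mem x → mem y
      ε-mem : mem ε
      ∙-mem : ∀ {x y} → mem x → mem y → mem (x ∙ y)
      ⁻¹-mem : ∀ {x} → mem x → mem (x ⁻¹)
  open Subgroup public

  SameElems : Subgroup → Subgroup → Set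
  SameElems S T = ∀ x → mem S x ⇔ mem T x

  Normal : Subgroup → Set
  Normal N = ∀ γ x → mem N x → mem N ((γ ⁻¹ ∙ x) ∙ γ)

  Malnormal : Subgroup → Set
  Malnormal A = ∀ γ → ¬ mem A γ → ∀ x → mem A x → mem A ((γ ⁻¹ ∙ x) ∙ γ) → x ≈ ε

  ConjClosed : (Subgroup → Set) → Set₁
  ConjClosed 𝒜 = ∀ A γ → 𝒜 A →
    ∃[ A' ] (𝒜 A' × (∀ x → mem A' x ⇔ mem A ((γ ∙ x) ∙ γ ⁻¹)))

  InFamily : Subgroup → (Subgroup → Set) → Subgroup → Set
  InFamily Γ₁ 𝒜 S = SameElems S Γ₁ ⊎ 𝒜 S

  Partitions : Subgroup → (Subgroup → Set) → Set₁
  Partitions Γ₁ 𝒜 = ∀ x → ¬ (x ≈ ε) →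
    (∃[ S ] (InFamily Γ₁ 𝒜 S × mem S x)) ×
    (∀ S T → InFamily Γ₁ 𝒜 S → InFamily Γ₁ 𝒜 T → mem S x → mem T x → SameElems S T)

-- Gain graphs: vertices Fin n, edges Fin m (loops / parallel edges allowed).
-- Each edge f has a reference orientation ends f = (a , b) with gain
-- gain f = ψ(f,a,b); then ψ(f,b,a) = (gain f)⁻¹ when a ≠ b.

  record GainGraph (n m : ℕ) : Set where
    field
      ends : Fin m → Fin n × Fin n
      gain : Fin m → Carrier
  open GainGraph public

  module _ {n m : ℕ} (G : GainGraph n m) where

    Joins : Fin m → Fin n → Fin n → Set
    Joins f u v = (ends G f ≡ (u , v)) ⊎ (ends G f ≡ (v , u))

    -- ψ(f,u,v) for an orientation (f,u,v) of f, determined by the tail u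
    ψ : Fin m → Fin n → Carrier
    ψ f u = if does (u ≟ proj₁ (ends G f)) then gain G f else gain G f ⁻¹

    IsEnd : Fin n → Fin m → Set
    IsEnd v f = (proj₁ (ends G f) ≡ v) ⊎ (proj₂ (ends G f) ≡ v)

    VOf : Subset m → Fin n → Set
    VOf X v = ∃[ f ] (f ∈ X × IsEnd v f)

    record Walk (k : ℕ) : Set where
      field
        vs   : Fin (suc k) → Fin n
        es   : Fin k → Fin m
        link : ∀ i → Joins (es i) (vs (inject₁ i)) (vs (Data.Fin.suc i))
        es-inj : ∀ i j → es i ≡ es j → i ≡ j
    open Walk public

    walkGain : ∀ {k} → Walk k → Carrier
    walkGain W = VF.foldr _∙_ ε (λ i → ψ (es W i) (vs W (inject₁ i)))

    EdgesOf : ∀ {k} → Walk k → Subset m → Set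
    EdgesOf W X = ∀ f → f ∈ X ⇔ (∃[ i ] (es W i ≡ f))

    IsCycleWalk : ∀ {k} → Walk (suc k) → Set
    IsCycleWalk {k} W = (vs W (fromℕ (suc k)) ≡ vs W Data.Fin.zero)
      × (∀ i j → vs W (inject₁ i) ≡ vs W (inject₁ j) → i ≡ j)

    IsPathWalk : ∀ {k} → Walk (suc k) → Set
    IsPathWalk W = ∀ i j → vs W i ≡ vs W j → i ≡ j

    IsCycle : Subset m → Set
    IsCycle C = ∃[ k ] Σ (Walk (suc k)) λ W → IsCycleWalk W × EdgesOf W C

    -- a cycle is balanced w.r.t. a predicate Bal on Γ (e.g. "≈ ε", or "∈ Γ₁"
    -- for ψ/Γ₁) if the gain along SOME simple closed walk around it satisfies Bal
    BalancedBy : (Carrier → Set) → Subset m → Set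
    BalancedBy Bal C = ∃[ k ] Σ (Walk (suc k)) λ W →
      IsCycleWalk W × EdgesOf W C × Bal (walkGain W)

    IsPathXY : Subset m → Fin n → Fin n → Set
    IsPathXY P x y = ∃[ k ] Σ (Walk (suc k)) λ W →
      IsPathWalk W × EdgesOf W P × vs W Data.Fin.zero ≡ x × vs W (fromℕ (suc k)) ≡ y

    Union2 : Subset m → Subset m → Subset m → Set
    Union2 X Y C = ∀ f → f ∈ C ⇔ (f ∈ X ⊎ f ∈ Y)

    Union3 : Subset m → Subset m → Subset m → Subset m → Set
    Union3 X Y Z C = ∀ f → f ∈ C ⇔ (f ∈ X ⊎ f ∈ Y ⊎ f ∈ Z)

    EdgeDisjoint : Subset m → Subset m → Set
    EdgeDisjoint X Y = ∀ f → f ∈ X → f ∈ Y → ⊥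

    TightHandcuff : Subset m → Subset m → Subset m → Set
    TightHandcuff C₁ C₂ C = IsCycle C₁ × IsCycle C₂ × EdgeDisjoint C₁ C₂ ×
      (∃[ x ] (VOf C₁ x × VOf C₂ x × (∀ y → VOf C₁ y → VOf C₂ y → y ≡ x))) ×
      Union2 C₁ C₂ C

    LooseHandcuff : Subset m → Subset m → Subset m → Set
    LooseHandcuff C₁ C₂ C = IsCycle C₁ × IsCycle C₂ ×
      (∀ v → VOf C₁ v → VOf C₂ v → ⊥) ×
      (∃[ P ] ∃[ x ] ∃[ y ] (IsPathXY P x y × VOf C₁ x × VOf C₂ y ×
         (∀ v → VOf P v → VOf C₁ v → v ≡ x) × (∀ v → VOf P v → VOf C₂ v → v ≡ y) ×
         Union3 C₁ C₂ P C))

    Handcuff : Subset m → Subset m → Subset m → Set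
    Handcuff C₁ C₂ C = TightHandcuff C₁ C₂ C ⊎ LooseHandcuff C₁ C₂ C

    Theta : Subset m → Set
    Theta C = ∃[ u ] ∃[ v ] (u ≢ v × ∃[ P₁ ] ∃[ P₂ ] ∃[ P₃ ] (
      IsPathXY P₁ u v × IsPathXY P₂ u v × IsPathXY P₃ u v ×
      EdgeDisjoint P₁ P₂ × EdgeDisjoint P₁ P₃ × EdgeDisjoint P₂ P₃ ×
      (∀ w → VOf P₁ w → VOf P₂ w → (w ≡ u ⊎ w ≡ v)) ×
      (∀ w → VOf P₁ w → VOf P₃ w → (w ≡ u ⊎ w ≡ v)) ×
      (∀ w → VOf P₂ w → VOf P₃ w → (w ≡ u ⊎ w ≡ v)) ×
      Union3 P₁ P₂ P₃ C))

    FrameCircuit : (Carrier → Set) → Subset m → Set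
    FrameCircuit Bal C =
      (IsCycle C × BalancedBy Bal C)
      ⊎ (∃[ C₁ ] ∃[ C₂ ] (Handcuff C₁ C₂ C × ¬ BalancedBy Bal C₁ × ¬ BalancedBy Bal C₂))
      ⊎ (Theta C × (∀ D → IsCycle D → D ⊆ C → ¬ BalancedBy Bal D))

    HandcuffOrTheta : Subset m → Set
    HandcuffOrTheta C = (∃[ C₁ ] ∃[ C₂ ] Handcuff C₁ C₂ C) ⊎ Theta C

    Indep : (Subset m → Set) → Subset m → Set
    Indep Circ I = ∀ C → C ⊆ I → Circ C → ⊥

    IsRankOf : (Subset m → Set) → Subset m → ℕ → Set
    IsRankOf Circ X k = (∃[ I ] (I ⊆ X × Indep Circ I × ∣ I ∣ ≡ k)) ×
      (∀ J → J ⊆ X → Indep Circ J → ∣ J ∣ ≤ k)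

    module _ (Γ₁ : Subgroup) (𝒜 : Subgroup → Set) where

      -- N = F(G, ψ/Γ₁): a cycle is balanced iff its gain maps to the identity of Γ/Γ₁
      CircN : Subset m → Set
      CircN = FrameCircuit (mem Γ₁)

      SwitchInto : (Fin n → Carrier) → Subgroup → Subset m → Set
      SwitchInto η A C = ∀ f → f ∈ C → ∀ u v → Joins f u v →
        mem A ((η u ⁻¹ ∙ ψ f u) ∙ η v)

      𝒞 : Subset m → Set₁
      𝒞 C = CircN C × ((IsCycle C × BalancedBy (_≈ ε) C) ⊎
        (HandcuffOrTheta C × ∃[ η ] ∃[ A ] (𝒜 A × SwitchInto η A C)))

      AllCircuitsIn𝒞 : Subset m → Set₁
      AllCircuitsIn𝒞 X = ∀ C → C ⊆ X → CircN C → 𝒞 C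

      RankM : Subset m → ℕ → Set₁
      RankM X k = (AllCircuitsIn𝒞 X × IsRankOf CircN X k)
        ⊎ (¬ AllCircuitsIn𝒞 X × ∃[ k' ] (IsRankOf CircN X k' × k ≡ suc k'))

  -- (G ∖ e, ψ restricted to E(G) - e); edges of G∖e are relabelled by punchIn e
  deleteEdge : ∀ {n m} → GainGraph n (suc m) → Fin (suc m) → GainGraph n m
  deleteEdge G e = record { ends = λ j → ends G (punchIn e j) ; gain = λ j → gain G (punchIn e j) }

preimage : ∀ {m m'} → (Fin m' → Fin m) → Subset m → Subset m'
preimage σ Y = VF.toVec (λ j → Data.Vec.lookup Y (σ j))
  where import Data.Vec

BijectionAvoiding : ∀ {m} → Fin (suc m) → (Fin m → Fin (suc m)) → Set
BijectionAvoiding e σ = (∀ i j → σ i ≡ σ j → i ≡ j) × (∀ i → σ i ≢ e) ×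
  (∀ f → f ≢ e → ∃[ i ] (σ i ≡ f))

-- M ∖ e ≅ M' : an isomorphism of the matroid M∖e (ground set E - e, rank
-- r_M restricted) with M' on ground set Fin m, given as rank relations
DeletionIso : ∀ {m} (e : Fin (suc m)) →
  (Subset (suc m) → ℕ → Set₁) → (Subset m → ℕ → Set₁) → Set₁
DeletionIso {m} e RM RM' = ∃[ σ ] (BijectionAvoiding e σ ×
  (∀ (Y : Subset (suc m)) (k : ℕ) → e ∉ Y → (RM Y k → RM' (preimage σ Y) k) × (RM' (preimage σ Y) k → RM Y k)))

{-# OPTIONS --safe #-}
-- Deleting e relabels the remaining edges by punchIn e.  Every notion entering
-- M (walks, cycles, paths, handcuffs, theta graphs, balance, switching,
-- circuits, independence, rank) refers only to the edges of the edge sets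
-- involved, so it is transported along C ↦ (image of C under punchIn e), a
-- cardinality-preserving bijection between edge sets of G ∖ e and edge sets of
-- G avoiding e.  No property of Γ₁ or 𝒜 is used, so the four hypotheses on
-- them are ignored.
module Submission where

open import Defs renaming (_⇔_ to _⇔′_)
open import Level using (Level; 0ℓ)
open import Algebra.Bundles using (Group)
open import Data.Nat using (ℕ; suc; _≤_)
open import Data.Fin using (Fin; punchIn; punchOut; _≟_)
open import Data.Fin.Properties using (punchIn-injective; punchIn-punchOut; punchInᵢ≢i)
open import Data.Fin.Subset using (Subset; _∈_; _∉_; _⊆_; ∣_∣; inside; outside)
open import Data.Fin.Subset.Properties using (_∈?_; ⊆-antisym)
open import Data.Product using (∃; ∃-syntax; _×_; _,_; proj₁; proj₂)
open import Data.Product.Function.NonDependent.Propositional using (_×-⇔_)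
open import Data.Sum using (_⊎_; inj₁; inj₂; [_,_])
open import Data.Sum.Function.Propositional using (_⊎-⇔_)
open import Data.Empty using (⊥; ⊥-elim)
open import Data.Vec using (lookup; insertAt; _∷_)
open import Data.Vec.Properties
  using (insertAt-punchIn; insertAt-lookup; []=⇒lookup; lookup⇒[]=; lookup∘tabulate)
open import Data.Vec.Functional.Relation.Binary.Pointwise.Properties using (foldr-cong)
open import Function using (_∘_; id)
open import Function.Bundles using (_⇔_; mk⇔; Equivalence)
open import Function.Construct.Composition using (_⇔-∘_)
open import Function.Construct.Identity using (⇔-id)
open import Function.Related.TypeIsomorphisms using (→-cong-⇔; ¬-cong-⇔)
open import Relation.Nullary using (¬_; yes; no)
open import Relation.Binary.PropositionalEquality using (_≡_; _≢_; refl; sym; trans; cong; cong₂; subst)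

open Equivalence using (to; from)

private
  variable
    a b ℓ : Level
    A A′ B B′ : Set a

-- Defs' _⇔_ (renamed _⇔′_) is a bare pair of maps between types in Set; the
-- transport lemmas use the level-polymorphic _⇔_ of Function.Bundles, as 𝒞 and
-- RankM live in Set₁.
⇔′-cong-⇔ : A ⇔ A′ → B ⇔ B′ → (A ⇔′ B) ⇔ (A′ ⇔′ B′)
⇔′-cong-⇔ A⇔A′ B⇔B′ = →-cong-⇔ A⇔A′ B⇔B′ ×-⇔ →-cong-⇔ B⇔B′ A⇔A′

∀-cong-⇔ : {P Q : A → Set b} → (∀ x → P x ⇔ Q x) → (∀ x → P x) ⇔ (∀ x → Q x)
∀-cong-⇔ P⇔Q = mk⇔ (λ p x → to (P⇔Q x) (p x)) (λ q x → from (P⇔Q x) (q x))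

∃-cong-⇔ : {P Q : A → Set b} → (∀ x → P x ⇔ Q x) → ∃ P ⇔ ∃ Q
∃-cong-⇔ P⇔Q = mk⇔ (λ (x , p) → x , to (P⇔Q x) p) (λ (x , q) → x , from (P⇔Q x) q)

subst-⇔ : (P : A → Set b) {x y : A} → x ≡ y → P x ⇔ P y
subst-⇔ P x≡y = mk⇔ (subst P x≡y) (subst P (sym x≡y))

∈-lookup : ∀ {k k′} {p : Subset k} {q : Subset k′} {i j} → lookup p i ≡ lookup q j → i ∈ p → j ∈ q
∈-lookup eq i∈p = lookup⇒[]= _ _ (trans (sym eq) ([]=⇒lookup i∈p))

∣insertAt-outside∣ : ∀ {k} (p : Subset k) i → ∣ insertAt p i outside ∣ ≡ ∣ p ∣
∣insertAt-outside∣ p            Fin.zero    = refl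
∣insertAt-outside∣ (inside ∷ p)  (Fin.suc i) = cong suc (∣insertAt-outside∣ p i)
∣insertAt-outside∣ (outside ∷ p) (Fin.suc i) = ∣insertAt-outside∣ p i

module EdgeImage {m : ℕ} (e : Fin (suc m)) where

  img : Subset m → Subset (suc m)
  img C = insertAt C e outside

  IsImage : Subset m → Subset (suc m) → Set
  IsImage C D = e ∉ D × (∀ j → j ∈ C ⇔ punchIn e j ∈ D)

  punchIn-bijectionAvoiding : BijectionAvoiding e (punchIn e)
  punchIn-bijectionAvoiding =
    punchIn-injective e , punchInᵢ≢i e , λ f f≢e → punchOut (f≢e ∘ sym) , punchIn-punchOut _

  img-isImage : ∀ C → IsImage C (img C)
  img-isImage C = e∉img , λ j →
    mk⇔ (∈-lookup (sym (insertAt-punchIn C e outside j))) (∈-lookup (insertAt-punchIn C e outside j))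
    where
    e∉img : e ∉ img C
    e∉img e∈img with () ← trans (sym (insertAt-lookup C e outside)) ([]=⇒lookup e∈img)

  preimage-isImage : ∀ {D} → e ∉ D → IsImage (preimage (punchIn e) D) D
  preimage-isImage e∉D = e∉D , λ j →
    mk⇔ (∈-lookup (lookup∘tabulate _ j)) (∈-lookup (sym (lookup∘tabulate _ j)))

  isImage-⊆-∉ : ∀ {C D D′} → IsImage C D → D′ ⊆ D → e ∉ D′
  isImage-⊆-∉ (e∉D , _) D′⊆D = e∉D ∘ D′⊆D

  ∀-punchIn : {P : Fin (suc m) → Set ℓ} → P e → (∀ j → P (punchIn e j)) ⇔ (∀ f → P f)
  ∀-punchIn {P = P} Pe = mk⇔ extend (λ p j → p (punchIn e j))
    where
    extend : (∀ j → P (punchIn e j)) → ∀ f → P f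
    extend p f with e ≟ f
    ... | yes refl = Pe
    ... | no e≢f   = subst P (punchIn-punchOut e≢f) (p (punchOut e≢f))

  ∃-punchIn : {P : Fin (suc m) → Set ℓ} → ¬ P e → (∃ λ j → P (punchIn e j)) ⇔ ∃ P
  ∃-punchIn {P = P} ¬Pe = mk⇔ (λ (j , p) → punchIn e j , p) restrict
    where
    restrict : ∃ P → ∃ λ j → P (punchIn e j)
    restrict (f , p) with e ≟ f
    ... | yes refl = ⊥-elim (¬Pe p)
    ... | no e≢f   = punchOut e≢f , subst P (sym (punchIn-punchOut e≢f)) p

  isImage-⊆ : ∀ {C C′ D D′} → IsImage C D → IsImage C′ D′ → (C ⊆ C′) ⇔ (D ⊆ D′)
  isImage-⊆ {C} {C′} {D} {D′} (e∉D , C⇔D) (_ , C′⇔D′) =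
    mk⇔ (λ C⊆C′ {f} → to pointwise (λ j → C⊆C′ {j}) f) (λ D⊆D′ {j} → from pointwise (λ f → D⊆D′ {f}) j)
    where
    pointwise : (∀ j → j ∈ C → j ∈ C′) ⇔ (∀ f → f ∈ D → f ∈ D′)
    pointwise = ∀-punchIn (⊥-elim ∘ e∉D) ⇔-∘ ∀-cong-⇔ (λ j → →-cong-⇔ (C⇔D j) (C′⇔D′ j))

  isImage-≡-img : ∀ {C D} → IsImage C D → D ≡ img C
  isImage-≡-img {C} im =
    ⊆-antisym (to (isImage-⊆ im (img-isImage C)) id) (to (isImage-⊆ (img-isImage C) im) id)

  isImage-∣∣ : ∀ {C D} → IsImage C D → ∣ C ∣ ≡ ∣ D ∣
  isImage-∣∣ {C} im = sym (trans (cong ∣_∣ (isImage-≡-img im)) (∣insertAt-outside∣ C e))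

  ∃-image : {P′ : Subset m → Set ℓ} {P : Subset (suc m) → Set ℓ} →
    (∀ {C D} → IsImage C D → P′ C ⇔ P D) → (∀ {D} → P D → e ∉ D) → ∃ P′ ⇔ ∃ P
  ∃-image P′⇔P avoids = mk⇔
    (λ (C , p) → img C , to (P′⇔P (img-isImage C)) p)
    (λ (D , p) → preimage (punchIn e) D , from (P′⇔P (preimage-isImage (avoids p))) p)

  ∀-image : {P′ : Subset m → Set ℓ} {P : Subset (suc m) → Set ℓ} →
    (∀ {C D} → IsImage C D → P′ C ⇔ P D) → (∀ {D} → e ∈ D → P D) → (∀ C → P′ C) ⇔ (∀ D → P D)
  ∀-image {P′ = P′} {P = P} P′⇔P vacuous = mk⇔ extend (λ p C → from (P′⇔P (img-isImage C)) (p (img C)))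
    where
    extend : (∀ C → P′ C) → ∀ D → P D
    extend p D with e ∈? D
    ... | yes e∈D = vacuous e∈D
    ... | no e∉D  = to (P′⇔P (preimage-isImage e∉D)) (p (preimage (punchIn e) D))

  ∃₂-image : {R′ : Subset m → Subset m → Set ℓ} {R : Subset (suc m) → Subset (suc m) → Set ℓ} →
    (∀ {C₁ D₁ C₂ D₂} → IsImage C₁ D₁ → IsImage C₂ D₂ → R′ C₁ C₂ ⇔ R D₁ D₂) →
    (∀ {D₁ D₂} → R D₁ D₂ → e ∉ D₁ × e ∉ D₂) →
    (∃[ C₁ ] ∃[ C₂ ] R′ C₁ C₂) ⇔ (∃[ D₁ ] ∃[ D₂ ] R D₁ D₂)
  ∃₂-image R′⇔R avoids =
    ∃-image (λ im₁ → ∃-image (λ im₂ → R′⇔R im₁ im₂) (proj₂ ∘ avoids)) (λ (_ , r) → proj₁ (avoids r))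

module Deletion (Γ : Group 0ℓ 0ℓ) {n m : ℕ} (G : GainGraph Γ n (suc m)) (e : Fin (suc m)) where
  open Group Γ using (_≈_; _∙_; ε)
  open EdgeImage e

  G′ : GainGraph Γ n m
  G′ = deleteEdge Γ G e

  liftWalk : ∀ {k} → Walk Γ G′ k → Walk Γ G k
  liftWalk W = record
    { vs = vs W ; es = punchIn e ∘ es W ; link = link W
    ; es-inj = λ i j eq → es-inj W i j (punchIn-injective e _ _ eq) }

  lowerWalk : ∀ {k} (W : Walk Γ G k) → (∀ i → e ≢ es W i) → Walk Γ G′ k
  lowerWalk W avoids = record
    { vs = vs W ; es = λ i → punchOut (avoids i)
    ; link = λ i → subst (λ f → Joins Γ G f _ _) (sym (punchIn-punchOut (avoids i))) (link W i)
    ; es-inj = λ i j eq → es-inj W i j (trans (sym (punchIn-punchOut (avoids i)))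
                                         (trans (cong (punchIn e) eq) (punchIn-punchOut (avoids j)))) }

  walkGain-lowerWalk : ∀ {k} (W : Walk Γ G k) avoids →
    walkGain Γ G′ (lowerWalk W avoids) ≡ walkGain Γ G W
  walkGain-lowerWalk W avoids = foldr-cong {R = _≡_} {S = _≡_} (cong₂ _∙_) refl
    (λ i → cong (λ f → ψ Γ G f (vs W _)) (punchIn-punchOut (avoids i)))

  edgesOf-cong : ∀ {k X} (W W′ : Walk Γ G k) → (∀ i → es W i ≡ es W′ i) →
    EdgesOf Γ G W X → EdgesOf Γ G W′ X
  edgesOf-cong _ _ es≡ eo f =
    (λ f∈X → let (i , eq) = proj₁ (eo f) f∈X in i , trans (sym (es≡ i)) eq) ,
    (λ (i , eq) → proj₂ (eo f) (i , trans (es≡ i) eq))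

  edgesOf-liftWalk : ∀ {k C D} (W : Walk Γ G′ k) → IsImage C D →
    EdgesOf Γ G′ W C ⇔ EdgesOf Γ G (liftWalk W) D
  edgesOf-liftWalk W (e∉D , C⇔D) =
    ∀-punchIn (⊥-elim ∘ e∉D , λ (_ , eq) → ⊥-elim (punchInᵢ≢i e _ eq)) ⇔-∘
    ∀-cong-⇔ (λ j → ⇔′-cong-⇔ (C⇔D j) (∃-cong-⇔ λ _ → mk⇔ (cong (punchIn e)) (punchIn-injective e _ _)))

  edgesOf-avoids : ∀ {k C D} (W : Walk Γ G k) → IsImage C D → EdgesOf Γ G W D → ∀ i → e ≢ es W i
  edgesOf-avoids W (e∉D , _) eo i e≡ = e∉D (subst (_∈ _) (sym e≡) (proj₂ (eo _) (i , refl)))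

  edgesOf-lowerWalk : ∀ {k C D} (W : Walk Γ G k) (im : IsImage C D) (eo : EdgesOf Γ G W D) →
    EdgesOf Γ G′ (lowerWalk W (edgesOf-avoids W im eo)) C
  edgesOf-lowerWalk {k} W im eo =
    from (edgesOf-liftWalk W↓ im)
         (edgesOf-cong W (liftWalk W↓) (λ i → sym (punchIn-punchOut (avoids i))) eo)
    where
    avoids : ∀ i → e ≢ es W i
    avoids = edgesOf-avoids W im eo
    W↓ : Walk Γ G′ k
    W↓ = lowerWalk W avoids

  isCycle-image : ∀ {C D} → IsImage C D → IsCycle Γ G′ C ⇔ IsCycle Γ G D
  isCycle-image im = mk⇔
    (λ (k , W , cyc , eo) → k , liftWalk W , cyc , to (edgesOf-liftWalk W im) eo)
    (λ (k , W , cyc , eo) → k , lowerWalk W (edgesOf-avoids W im eo) , cyc , edgesOf-lowerWalk W im eo)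

  balancedBy-image : ∀ {Bal C D} → IsImage C D → BalancedBy Γ G′ Bal C ⇔ BalancedBy Γ G Bal D
  balancedBy-image {Bal} im = mk⇔
    (λ (k , W , cyc , eo , bal) → k , liftWalk W , cyc , to (edgesOf-liftWalk W im) eo , bal)
    (λ (k , W , cyc , eo , bal) → k , lowerWalk W (edgesOf-avoids W im eo) , cyc ,
       edgesOf-lowerWalk W im eo , subst Bal (sym (walkGain-lowerWalk W (edgesOf-avoids W im eo))) bal)

  isPathXY-image : ∀ {C D x y} → IsImage C D → IsPathXY Γ G′ C x y ⇔ IsPathXY Γ G D x y
  isPathXY-image im = mk⇔
    (λ (k , W , path , eo , ends) → k , liftWalk W , path , to (edgesOf-liftWalk W im) eo , ends)
    (λ (k , W , path , eo , ends) → k , lowerWalk W (edgesOf-avoids W im eo) , path ,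
       edgesOf-lowerWalk W im eo , ends)

  vOf-image : ∀ {C D v} → IsImage C D → VOf Γ G′ C v ⇔ VOf Γ G D v
  vOf-image (e∉D , C⇔D) = ∃-punchIn (e∉D ∘ proj₁) ⇔-∘ ∃-cong-⇔ (λ j → C⇔D j ×-⇔ ⇔-id _)

  sharedVertices-image : ∀ {X X′ Y Y′} {Q : Fin n → Set} → IsImage X X′ → IsImage Y Y′ →
    (∀ v → VOf Γ G′ X v → VOf Γ G′ Y v → Q v) ⇔ (∀ v → VOf Γ G X′ v → VOf Γ G Y′ v → Q v)
  sharedVertices-image imX imY =
    ∀-cong-⇔ λ _ → →-cong-⇔ (vOf-image imX) (→-cong-⇔ (vOf-image imY) (⇔-id _))

  edgeDisjoint-image : ∀ {X X′ Y Y′} → IsImage X X′ → IsImage Y Y′ →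
    EdgeDisjoint Γ G′ X Y ⇔ EdgeDisjoint Γ G X′ Y′
  edgeDisjoint-image (e∉X′ , X⇔X′) (_ , Y⇔Y′) =
    ∀-punchIn (⊥-elim ∘ e∉X′) ⇔-∘ ∀-cong-⇔ (λ j → →-cong-⇔ (X⇔X′ j) (→-cong-⇔ (Y⇔Y′ j) (⇔-id _)))

  union2-image : ∀ {X X′ Y Y′ C D} → IsImage X X′ → IsImage Y Y′ → IsImage C D →
    Union2 Γ G′ X Y C ⇔ Union2 Γ G X′ Y′ D
  union2-image (e∉X′ , X⇔X′) (e∉Y′ , Y⇔Y′) (e∉D , C⇔D) =
    ∀-punchIn (⊥-elim ∘ e∉D , [ ⊥-elim ∘ e∉X′ , ⊥-elim ∘ e∉Y′ ]) ⇔-∘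
    ∀-cong-⇔ (λ j → ⇔′-cong-⇔ (C⇔D j) (X⇔X′ j ⊎-⇔ Y⇔Y′ j))

  union3-image : ∀ {X X′ Y Y′ Z Z′ C D} → IsImage X X′ → IsImage Y Y′ → IsImage Z Z′ → IsImage C D →
    Union3 Γ G′ X Y Z C ⇔ Union3 Γ G X′ Y′ Z′ D
  union3-image (e∉X′ , X⇔X′) (e∉Y′ , Y⇔Y′) (e∉Z′ , Z⇔Z′) (e∉D , C⇔D) =
    ∀-punchIn (⊥-elim ∘ e∉D , [ ⊥-elim ∘ e∉X′ , [ ⊥-elim ∘ e∉Y′ , ⊥-elim ∘ e∉Z′ ] ]) ⇔-∘
    ∀-cong-⇔ (λ j → ⇔′-cong-⇔ (C⇔D j) (X⇔X′ j ⊎-⇔ Y⇔Y′ j ⊎-⇔ Z⇔Z′ j))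

  union2-∉ : ∀ {X Y D} → e ∉ D → Union2 Γ G X Y D → e ∉ X × e ∉ Y
  union2-∉ e∉D u = e∉D ∘ proj₂ (u e) ∘ inj₁ , e∉D ∘ proj₂ (u e) ∘ inj₂

  union3-∉ : ∀ {X Y Z D} → e ∉ D → Union3 Γ G X Y Z D → e ∉ X × e ∉ Y × e ∉ Z
  union3-∉ e∉D u =
    e∉D ∘ proj₂ (u e) ∘ inj₁ , e∉D ∘ proj₂ (u e) ∘ inj₂ ∘ inj₁ , e∉D ∘ proj₂ (u e) ∘ inj₂ ∘ inj₂

  tightHandcuff-image : ∀ {C₁ D₁ C₂ D₂ C D} → IsImage C₁ D₁ → IsImage C₂ D₂ → IsImage C D →
    TightHandcuff Γ G′ C₁ C₂ C ⇔ TightHandcuff Γ G D₁ D₂ D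
  tightHandcuff-image im₁ im₂ im =
    isCycle-image im₁ ×-⇔ isCycle-image im₂ ×-⇔ edgeDisjoint-image im₁ im₂ ×-⇔
    ∃-cong-⇔ (λ _ → vOf-image im₁ ×-⇔ vOf-image im₂ ×-⇔ sharedVertices-image im₁ im₂) ×-⇔
    union2-image im₁ im₂ im

  looseHandcuff-image : ∀ {C₁ D₁ C₂ D₂ C D} → IsImage C₁ D₁ → IsImage C₂ D₂ → IsImage C D →
    LooseHandcuff Γ G′ C₁ C₂ C ⇔ LooseHandcuff Γ G D₁ D₂ D
  looseHandcuff-image im₁ im₂ im =
    isCycle-image im₁ ×-⇔ isCycle-image im₂ ×-⇔ sharedVertices-image im₁ im₂ ×-⇔
    ∃-image (λ imP → ∃-cong-⇔ λ _ → ∃-cong-⇔ λ _ →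
        isPathXY-image imP ×-⇔ vOf-image im₁ ×-⇔ vOf-image im₂ ×-⇔
        sharedVertices-image imP im₁ ×-⇔ sharedVertices-image imP im₂ ×-⇔ union3-image im₁ im₂ imP im)
      (λ (_ , _ , _ , _ , _ , _ , _ , u) → proj₂ (proj₂ (union3-∉ (proj₁ im) u)))

  handcuff-image : ∀ {C₁ D₁ C₂ D₂ C D} → IsImage C₁ D₁ → IsImage C₂ D₂ → IsImage C D →
    Handcuff Γ G′ C₁ C₂ C ⇔ Handcuff Γ G D₁ D₂ D
  handcuff-image im₁ im₂ im = tightHandcuff-image im₁ im₂ im ⊎-⇔ looseHandcuff-image im₁ im₂ im

  handcuff-∉ : ∀ {D₁ D₂ D} → e ∉ D → Handcuff Γ G D₁ D₂ D → e ∉ D₁ × e ∉ D₂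
  handcuff-∉ e∉D (inj₁ (_ , _ , _ , _ , u)) = union2-∉ e∉D u
  handcuff-∉ e∉D (inj₂ (_ , _ , _ , _ , _ , _ , _ , _ , _ , _ , _ , u)) =
    let (e∉D₁ , e∉D₂ , _) = union3-∉ e∉D u in e∉D₁ , e∉D₂

  theta-image : ∀ {C D} → IsImage C D → Theta Γ G′ C ⇔ Theta Γ G D
  theta-image im = ∃-cong-⇔ λ _ → ∃-cong-⇔ λ _ → ⇔-id _ ×-⇔
    ∃-image (λ im₁ → ∃-image (λ im₂ → ∃-image (λ im₃ →
          isPathXY-image im₁ ×-⇔ isPathXY-image im₂ ×-⇔ isPathXY-image im₃ ×-⇔
          edgeDisjoint-image im₁ im₂ ×-⇔ edgeDisjoint-image im₁ im₃ ×-⇔ edgeDisjoint-image im₂ im₃ ×-⇔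
          sharedVertices-image im₁ im₂ ×-⇔ sharedVertices-image im₁ im₃ ×-⇔ sharedVertices-image im₂ im₃ ×-⇔
          union3-image im₁ im₂ im₃ im)
        (λ (_ , _ , _ , _ , _ , _ , _ , _ , _ , u) → proj₂ (proj₂ (union3-∉ (proj₁ im) u))))
        (λ (_ , _ , _ , _ , _ , _ , _ , _ , _ , _ , u) → proj₁ (proj₂ (union3-∉ (proj₁ im) u))))
        (λ (_ , _ , _ , _ , _ , _ , _ , _ , _ , _ , _ , u) → proj₁ (union3-∉ (proj₁ im) u))

  frameCircuit-image : ∀ {Bal C D} → IsImage C D → FrameCircuit Γ G′ Bal C ⇔ FrameCircuit Γ G Bal D
  frameCircuit-image {Bal} im =
    (isCycle-image im ×-⇔ balancedBy-image {Bal} im) ⊎-⇔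
    ∃₂-image (λ im₁ im₂ → handcuff-image im₁ im₂ im ×-⇔
                          ¬-cong-⇔ (balancedBy-image {Bal} im₁) ×-⇔ ¬-cong-⇔ (balancedBy-image {Bal} im₂))
             (handcuff-∉ (proj₁ im) ∘ proj₁) ⊎-⇔
    (theta-image im ×-⇔
     ∀-image (λ im′ → →-cong-⇔ (isCycle-image im′)
                        (→-cong-⇔ (isImage-⊆ im′ im) (¬-cong-⇔ (balancedBy-image {Bal} im′))))
             (λ e∈D′ _ D′⊆D → ⊥-elim (isImage-⊆-∉ im D′⊆D e∈D′)))

  indep-image : ∀ {Circ′ : Subset m → Set} {Circ : Subset (suc m) → Set} {I J} →
    (∀ {C D} → IsImage C D → Circ′ C ⇔ Circ D) → IsImage I J → Indep Γ G′ Circ′ I ⇔ Indep Γ G Circ J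
  indep-image circ imI = ∀-image (λ im → →-cong-⇔ (isImage-⊆ im imI) (→-cong-⇔ (circ im) (⇔-id _)))
    (λ e∈D D⊆J → ⊥-elim (isImage-⊆-∉ imI D⊆J e∈D))

  isRankOf-image : ∀ {Circ′ : Subset m → Set} {Circ : Subset (suc m) → Set} {X Y k} →
    (∀ {C D} → IsImage C D → Circ′ C ⇔ Circ D) → IsImage X Y →
    IsRankOf Γ G′ Circ′ X k ⇔ IsRankOf Γ G Circ Y k
  isRankOf-image {k = k} circ imX =
    ∃-image (λ im → isImage-⊆ im imX ×-⇔ indep-image circ im ×-⇔ subst-⇔ (_≡ k) (isImage-∣∣ im))
            (λ (I⊆Y , _) → isImage-⊆-∉ imX I⊆Y) ×-⇔
    ∀-image (λ im → →-cong-⇔ (isImage-⊆ im imX)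
                      (→-cong-⇔ (indep-image circ im) (subst-⇔ (_≤ k) (isImage-∣∣ im))))
            (λ e∈J J⊆Y → ⊥-elim (isImage-⊆-∉ imX J⊆Y e∈J))

  module _ (Γ₁ : Subgroup Γ) (𝒜 : Subgroup Γ → Set) where

    circN-image : ∀ {C D} → IsImage C D → CircN Γ G′ Γ₁ 𝒜 C ⇔ CircN Γ G Γ₁ 𝒜 D
    circN-image = frameCircuit-image {mem Γ₁}

    switchInto-image : ∀ {η A C D} → IsImage C D → SwitchInto Γ G′ Γ₁ 𝒜 η A C ⇔ SwitchInto Γ G Γ₁ 𝒜 η A D
    switchInto-image (e∉D , C⇔D) = ∀-punchIn (⊥-elim ∘ e∉D) ⇔-∘ ∀-cong-⇔ (λ j → →-cong-⇔ (C⇔D j) (⇔-id _))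

    handcuffOrTheta-image : ∀ {C D} → IsImage C D → HandcuffOrTheta Γ G′ C ⇔ HandcuffOrTheta Γ G D
    handcuffOrTheta-image im =
      ∃₂-image (λ im₁ im₂ → handcuff-image im₁ im₂ im) (handcuff-∉ (proj₁ im)) ⊎-⇔ theta-image im

    𝒞-image : ∀ {C D} → IsImage C D → 𝒞 Γ G′ Γ₁ 𝒜 C ⇔ 𝒞 Γ G Γ₁ 𝒜 D
    𝒞-image im = circN-image im ×-⇔
      ((isCycle-image im ×-⇔ balancedBy-image {_≈ ε} im) ⊎-⇔
       (handcuffOrTheta-image im ×-⇔
        ∃-cong-⇔ λ η → ∃-cong-⇔ λ A → ⇔-id _ ×-⇔ switchInto-image {η} {A} im))

    allCircuitsIn𝒞-image : ∀ {X Y} → IsImage X Y → AllCircuitsIn𝒞 Γ G′ Γ₁ 𝒜 X ⇔ AllCircuitsIn𝒞 Γ G Γ₁ 𝒜 Y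
    allCircuitsIn𝒞-image imX =
      ∀-image (λ im → →-cong-⇔ (isImage-⊆ im imX) (→-cong-⇔ (circN-image im) (𝒞-image im)))
              (λ e∈C C⊆Y → ⊥-elim (isImage-⊆-∉ imX C⊆Y e∈C))

    rankM-image : ∀ {X Y k} → IsImage X Y → RankM Γ G′ Γ₁ 𝒜 X k ⇔ RankM Γ G Γ₁ 𝒜 Y k
    rankM-image imX =
      (allCircuitsIn𝒞-image imX ×-⇔ isRankOf-image circN-image imX) ⊎-⇔
      (¬-cong-⇔ (allCircuitsIn𝒞-image imX) ×-⇔ ∃-cong-⇔ λ _ → isRankOf-image circN-image imX ×-⇔ ⇔-id _)

lemma4p6 : (Γ : Group 0ℓ 0ℓ) (Γ₁ : Subgroup Γ) (𝒜 : Subgroup Γ → Set) →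
    Normal Γ Γ₁ → Partitions Γ Γ₁ 𝒜 → (∀ A → 𝒜 A → Malnormal Γ A) → ConjClosed Γ 𝒜 →
    {n m : ℕ} (G : GainGraph Γ n (suc m)) (e : Fin (suc m)) →
    DeletionIso e (RankM Γ G Γ₁ 𝒜) (RankM Γ (deleteEdge Γ G e) Γ₁ 𝒜)
lemma4p6 Γ Γ₁ 𝒜 _ _ _ _ G e =
  punchIn e , punchIn-bijectionAvoiding , λ Y k e∉Y →
    let M∖e≅M′ = rankM-image Γ₁ 𝒜 (preimage-isImage e∉Y) in from M∖e≅M′ , to M∖e≅M′
  where
  open EdgeImage e
  open Deletion Γ G e
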